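{- For $k\ge1$, $$|\operatorname{ParSeq}(n,k)|=2\,|\operatorname{ParSeq}(n-1,k)|+\sum_{i=k+1}^{n-1}|\operatorname{ParSeq}(i,k-1)|.$$
   Context: $\operatorname{Val}(n)$: partitions $\lambda$ contained in a $\operatorname{length}(\lambda)\times(n-\operatorname{length}(\lambda))$ rectangle, neither empty nor the full rectangle. $\operatorname{ParSeq}(n,0)$ consists of one element, the empty sequence. For $1\le k\le n-2$, $\operatorname{ParSeq}(n,k)$ is the set of sequences $(\lambda^1,\dots,\lambda^k)$ with each $\lambda^i\in\operatorname{Val}(n)$ such that for $1\le i\le k-1$, if $\ell$ is the smallest part of $\lambda^i$, then the first $n-\ell$ parts of $\lambda^{i+1}$ are equal. (For other values of $k$ the set is empty.) -}

module Defs where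

open import Data.Nat using (ℕ; zero; suc; _+_; _*_; _∸_; _≤_; _<_; _⊓_)
open import Data.Nat.Properties using (_≟_)
open import Data.List using (List; []; _∷_; length; take; replicate; _++_; applyUpTo)
open import Data.Nat.ListAction using (sum)
open import Data.List.Relation.Unary.All using (All; all?)
open import Data.List.Relation.Unary.Linked using (Linked)
open import Data.Vec using (Vec; []; _∷_)
open import Data.Product using (Σ; _×_; _,_)
open import Data.Unit using (⊤)
open import Relation.Nullary.Decidable using (False)
open import Relation.Binary.PropositionalEquality using (_≡_)

IsPartition : List ℕ → Set
IsPartition λs = Linked (λ a b → b ≤ a) λs × All (λ x → 0 < x) λs

smallestPart : List ℕ → ℕ
smallestPart []           = 0
smallestPart (x ∷ [])     = x
smallestPart (x ∷ y ∷ r)  = x ⊓ smallestPart (y ∷ r)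

-- λ ∈ Val(n): a partition λ with ℓ = length λ parts, contained in an
-- ℓ × (n - ℓ) rectangle (all parts ≤ n - ℓ), not empty (ℓ > 0), and not the
-- full rectangle (not all parts equal to n - ℓ).
IsVal : ℕ → List ℕ → Set
IsVal n λs =
  IsPartition λs
  × 0 < length λs
  × All (λ x → x ≤ n ∸ length λs) λs
  × False (all? (λ x → x ≟ (n ∸ length λs)) λs)

Val : ℕ → Set
Val n = Σ (List ℕ) (IsVal n)

FirstPartsEqual : ℕ → List ℕ → Set
FirstPartsEqual m []      = All (λ x → x ≡ 0) (take m (replicate m 0))
FirstPartsEqual m (h ∷ r) = All (λ x → x ≡ h) (take m (h ∷ r ++ replicate m 0))

Compatible : (n : ℕ) → Val n → Val n → Set
Compatible n (λs , _) (μ , _) = FirstPartsEqual (n ∸ smallestPart λs) μ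

Chain : (n : ℕ) {k : ℕ} → Vec (Val n) k → Set
Chain n []           = ⊤
Chain n (x ∷ [])     = ⊤
Chain n (x ∷ y ∷ r)  = Compatible n x y × Chain n (y ∷ r)

ParSeq : ℕ → ℕ → Set
ParSeq n zero    = ⊤
ParSeq n (suc k) = (suc k ≤ n ∸ 2) × Σ (Vec (Val n) (suc k)) (Chain n)

-- Σ_{i=a}^{b} f i   (empty when b < a)
sumFromTo : ℕ → ℕ → (ℕ → ℕ) → ℕ
sumFromTo a b f = sum (applyUpTo (λ j → f (a + j)) (suc b ∸ a))

{-# OPTIONS --safe #-}

-- Each entry of a sequence in ParSeq(n,k) after the first has n − ℓ ≥ 2 equal leading parts,
-- ℓ the smallest part of its predecessor, so the first part of all of them can be deleted without
-- changing smallest parts.  Doing so n − ℓ − 1 times, ℓ now the smallest part of λ¹, leaves a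
-- sequence in ParSeq(ℓ+1, k−1); hence |ParSeq(n,k)| = Σ_{λ ∈ Val(n)} |ParSeq(ℓ(λ)+1, k−1)|.
-- Val(n+1) splits, preserving smallest parts, into two copies of Val(n) (λ₁ = λ₂: delete λ₁;
-- λ₁ > λ₂: lower λ₁ by one, trading the full rectangles this produces for one-row partitions)
-- and the one-row partitions (q), 1 ≤ q ≤ n−1, which contribute Σ_{i=2}^{n} |ParSeq(i,k−1)|;
-- the terms with i ≤ k vanish.
module Submission where

open import Defs
open import Data.Bool using (Bool; true; false; not; T)
open import Data.Bool.Properties using (T-irrelevant)
open import Data.Empty using (⊥-elim)
open import Data.Fin using (Fin; zero)
open import Data.Fin.Properties using (+↔⊎; cantor-schröder-bernstein)
open import Data.List using (List; []; _∷_; length; take; drop; replicate; _++_; applyUpTo)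
open import Data.List.Properties using (length-replicate)
open import Data.List.Relation.Unary.All as All using (All; []; _∷_; all?)
open import Data.List.Relation.Unary.All.Properties using (replicate⁺)
open import Data.List.Relation.Unary.Linked as Linked using (Linked; [-]; _∷_)
open import Data.List.Relation.Unary.Linked.Properties using (Linked⇒All)
open import Data.Nat
open import Data.Nat.ListAction using (sum)
open import Data.Nat.Properties
open import Data.Product using (Σ; _×_; _,_; proj₁; proj₂)
open import Data.Product.Function.Dependent.Propositional using (Σ-↔)
open import Data.Product.Properties using (Σ-≡,≡→≡)
open import Data.Sum using (_⊎_; inj₁; inj₂)
open import Data.Sum.Function.Propositional using (_⊎-↔_)
open import Data.Unit using (⊤; tt)
open import Data.Vec using (Vec; []; _∷_; map)
open import Function using (_∘_; id)
open import Function.Bundles using (_↔_; Inverse; Injection; mk↔ₛ′)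
open import Function.Properties.Inverse using (↔-refl; ↔-sym; ↔-trans; ↔⇒↣)
open import Function.Related.Propositional using (module EquationalReasoning; ≡⇒)
open import Relation.Binary.PropositionalEquality
open import Relation.Nullary using (¬_; Dec; yes; no)
open import Relation.Nullary.Decidable using (isYes; toWitness; fromWitness; toWitnessFalse; fromWitnessFalse)
open import Relation.Unary using (Irrelevant)

-- Bijections between Σ-types

module _ {A B : Set} {P : A → Set} {Q : B → Set} (P-irr : Irrelevant P) (Q-irr : Irrelevant Q)
  (f : A → B) (g : B → A) (f-pres : ∀ {a} → P a → Q (f a)) (g-pres : ∀ {b} → Q b → P (g b)) where

  Σ-restrict-↔ : (∀ {a} → P a → g (f a) ≡ a) → (∀ {b} → Q b → f (g b) ≡ b) → Σ A P ↔ Σ B Q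
  Σ-restrict-↔ g∘f f∘g = mk↔ₛ′ (λ (a , p) → f a , f-pres p) (λ (b , q) → g b , g-pres q)
    (λ (b , q) → Σ-≡,≡→≡ (f∘g q , Q-irr _ _))
    (λ (a , p) → Σ-≡,≡→≡ (g∘f p , P-irr _ _))

Σ-⇔-↔ : {A : Set} {P Q : A → Set} → Irrelevant P → Irrelevant Q
  → (∀ {a} → P a → Q a) → (∀ {a} → Q a → P a) → Σ A P ↔ Σ A Q
Σ-⇔-↔ P-irr Q-irr to from = Σ-restrict-↔ P-irr Q-irr id id to from (λ _ → refl) (λ _ → refl)

Σ-reweight-↔ : {X Y : Set} (F : ℕ → Set) {wX : X → ℕ} {wY : Y → ℕ} (e : X ↔ Y)
  → (∀ x → wY (Inverse.to e x) ≡ wX x) → Σ X (F ∘ wX) ↔ Σ Y (F ∘ wY)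
Σ-reweight-↔ F e w = Σ-↔ e (λ {x} → ≡⇒ (cong F (sym (w x))))

×-irrelevant : {A B : Set} → (∀ (a a' : A) → a ≡ a') → (∀ (b b' : B) → b ≡ b')
  → ∀ (p q : A × B) → p ≡ q
×-irrelevant A-irr B-irr (a , b) (a' , b') = cong₂ _,_ (A-irr a a') (B-irr b b')

module _ {A : Set} {P : A → Set} (X : A → Set) (c : A → Bool) where

  private
    Passing Failing : Set
    Passing = Σ (Σ A (λ a → P a × T (c a))) (X ∘ proj₁)
    Failing = Σ (Σ A (λ a → P a × T (not (c a)))) (X ∘ proj₁)

    classify : ∀ a → P a → X a → (b : Bool) → c a ≡ b → Passing ⊎ Failing
    classify a p x true  e = inj₁ ((a , p , subst T (sym e) tt) , x)
    classify a p x false e = inj₂ ((a , p , subst (T ∘ not) (sym e) tt) , x)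

    forget : Passing ⊎ Failing → Σ (Σ A P) (X ∘ proj₁)
    forget (inj₁ ((a , p , _) , x)) = (a , p) , x
    forget (inj₂ ((a , p , _) , x)) = (a , p) , x

    forget-classify : ∀ a p x b (e : c a ≡ b) → forget (classify a p x b e) ≡ ((a , p) , x)
    forget-classify a p x true  e = refl
    forget-classify a p x false e = refl

    classify-passing : ∀ a p x b (e : c a ≡ b) (t : T (c a))
      → classify a p x b e ≡ inj₁ ((a , p , t) , x)
    classify-passing a p x true  e t = cong (λ t' → inj₁ ((a , p , t') , x)) (T-irrelevant _ t)
    classify-passing a p x false e t = ⊥-elim (subst T e t)

    classify-failing : ∀ a p x b (e : c a ≡ b) (t : T (not (c a)))
      → classify a p x b e ≡ inj₂ ((a , p , t) , x)
    classify-failing a p x false e t = cong (λ t' → inj₂ ((a , p , t') , x)) (T-irrelevant _ t)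
    classify-failing a p x true  e t = ⊥-elim (subst (T ∘ not) e t)

  Σ-split-↔ : Σ (Σ A P) (X ∘ proj₁) ↔ (Passing ⊎ Failing)
  Σ-split-↔ = mk↔ₛ′ (λ ((a , p) , x) → classify a p x (c a) refl) forget
    (λ { (inj₁ ((a , p , t) , x)) → classify-passing a p x (c a) refl t
       ; (inj₂ ((a , p , t) , x)) → classify-failing a p x (c a) refl t })
    (λ ((a , p) , x) → forget-classify a p x (c a) refl)

Σ-Vec-uncons-↔ : ∀ {A : Set} {m} (P : Vec A (suc m) → Set)
  → Σ (Vec A (suc m)) P ↔ Σ A (λ x → Σ (Vec A m) (λ v → P (x ∷ v)))
Σ-Vec-uncons-↔ P = mk↔ₛ′ (λ { (x ∷ v , p) → x , v , p }) (λ (x , v , p) → x ∷ v , p)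
  (λ _ → refl) (λ { (_ ∷ _ , _) → refl })

-- Counting

Fin-↔-injective : ∀ {m n} → Fin m ↔ Fin n → m ≡ n
Fin-↔-injective e = cantor-schröder-bernstein (Injection.injective (↔⇒↣ e)) (Injection.injective (↔⇒↣ (↔-sym e)))

↔Fin⇒≡0 : ∀ {A : Set} {n} → ¬ A → A ↔ Fin n → n ≡ 0
↔Fin⇒≡0 {n = zero}  ¬a e = refl
↔Fin⇒≡0 {n = suc n} ¬a e = ⊥-elim (¬a (Inverse.from e zero))

Σ<↔Fin-sum : (X : ℕ → Set) (g : ℕ → ℕ) → (∀ j → X j ↔ Fin (g j))
  → ∀ N → Σ (Σ ℕ (_< N)) (X ∘ proj₁) ↔ Fin (sum (applyUpTo g N))
Σ<↔Fin-sum X g e zero = mk↔ₛ′ (λ { ((_ , ()) , _) }) (λ ()) (λ ()) (λ { ((_ , ()) , _) })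
Σ<↔Fin-sum X g e (suc N) = begin
  Σ (Σ ℕ (_< suc N)) (X ∘ proj₁)                 ↔⟨ peel ⟩
  (X 0 ⊎ Σ (Σ ℕ (_< N)) (X ∘ suc ∘ proj₁))       ↔⟨ e 0 ⊎-↔ Σ<↔Fin-sum (X ∘ suc) (g ∘ suc) (e ∘ suc) N ⟩
  (Fin (g 0) ⊎ Fin (sum (applyUpTo (g ∘ suc) N))) ↔⟨ +↔⊎ ⟨
  Fin (sum (applyUpTo g (suc N)))                ∎
  where
  open EquationalReasoning
  peel : Σ (Σ ℕ (_< suc N)) (X ∘ proj₁) ↔ (X 0 ⊎ Σ (Σ ℕ (_< N)) (X ∘ suc ∘ proj₁))
  peel = mk↔ₛ′
    (λ { ((zero , _) , x) → inj₁ x ; ((suc j , s≤s j<N) , x) → inj₂ ((j , j<N) , x) })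
    (λ { (inj₁ x) → (zero , s≤s z≤n) , x ; (inj₂ ((j , j<N) , x)) → (suc j , s≤s j<N) , x })
    (λ { (inj₁ x) → refl ; (inj₂ _) → refl })
    (λ { ((zero , s≤s z≤n) , x) → refl ; ((suc j , s≤s j<N) , x) → refl })

sum-applyUpTo-dropZeros : ∀ t N (g : ℕ → ℕ) → (∀ j → j < t → g j ≡ 0)
  → sum (applyUpTo g N) ≡ sum (applyUpTo (g ∘ (t +_)) (N ∸ t))
sum-applyUpTo-dropZeros zero    N       g zeros = refl
sum-applyUpTo-dropZeros (suc t) zero    g zeros = refl
sum-applyUpTo-dropZeros (suc t) (suc N) g zeros =
  trans (cong (_+ sum (applyUpTo (g ∘ suc) N)) (zeros 0 z<s))
        (sum-applyUpTo-dropZeros t N (g ∘ suc) (λ j j<t → zeros (suc j) (s≤s j<t)))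

-- Partitions in Val n

smallestPart-≤-head : ∀ h r → smallestPart (h ∷ r) ≤ h
smallestPart-≤-head h []      = ≤-refl
smallestPart-≤-head h (_ ∷ _) = m⊓n≤m h _

smallestPart-positive : ∀ {h r} → All (0 <_) (h ∷ r) → 0 < smallestPart (h ∷ r)
smallestPart-positive {r = []}    (p ∷ _)  = p
smallestPart-positive {r = _ ∷ _} (p ∷ ps) = ⊓-pres-m< p (smallestPart-positive ps)

smallestPart-all≡ : ∀ {v h r} → All (_≡ v) (h ∷ r) → smallestPart (h ∷ r) ≡ v
smallestPart-all≡ {r = []}    (e ∷ []) = e
smallestPart-all≡ {v} {r = _ ∷ _} (e ∷ es) = trans (cong₂ _⊓_ e (smallestPart-all≡ es)) (⊓-idem v)

smallestPart-bounds : ∀ {n xs} → IsVal n xs → 1 ≤ smallestPart xs × smallestPart xs ≤ n ∸ 2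
smallestPart-bounds {n} {h ∷ []} ((_ , h>0 ∷ _) , _ , h≤ ∷ _ , notFull) =
  h>0 , subst (h ≤_) (∸-+-assoc n 1 1) (<⇒≤pred (≤∧≢⇒< h≤ (λ h≡ → toWitnessFalse notFull (h≡ ∷ []))))
smallestPart-bounds {n} {h ∷ h' ∷ r} ((_ , pos) , _ , h≤ ∷ _ , _) =
  smallestPart-positive pos , ≤-trans (smallestPart-≤-head h (h' ∷ r)) (≤-trans h≤ (∸-monoʳ-≤ n (s≤s (s≤s z≤n))))

1+smallestPart<n : ∀ {n xs} → IsVal n xs → suc (smallestPart xs) < n
1+smallestPart<n {n} val = bound n (smallestPart-bounds val)
  where
  bound : ∀ n {s} → 1 ≤ s × s ≤ n ∸ 2 → suc s < n
  bound zero          (s≤s _ , ())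
  bound (suc zero)    (s≤s _ , ())
  bound (suc (suc n)) (_     , s≤n) = s≤s (s≤s s≤n)

smallestPart<n : ∀ {n xs} → IsVal n xs → smallestPart xs < n
smallestPart<n val = <-trans (n<1+n _) (1+smallestPart<n val)

IsVal-irrelevant : ∀ {n} → Irrelevant (IsVal n)
IsVal-irrelevant ((ord , pos) , len , bnd , nf) ((ord' , pos') , len' , bnd' , nf') =
  cong₂ _,_ (cong₂ _,_ (Linked.irrelevant ≤-irrelevant ord ord') (All.irrelevant <-irrelevant pos pos'))
            (cong₂ _,_ (<-irrelevant len len') (cong₂ _,_ (All.irrelevant ≤-irrelevant bnd bnd') (T-irrelevant nf nf')))

FirstPartsEqual-irrelevant : ∀ {d} → Irrelevant (FirstPartsEqual d)
FirstPartsEqual-irrelevant {x = []}    = All.irrelevant ≡-irrelevant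
FirstPartsEqual-irrelevant {x = _ ∷ _} = All.irrelevant ≡-irrelevant

-- Repeating the first part

data RepeatedHead : List ℕ → Set where
  repeated : ∀ h r → RepeatedHead (h ∷ h ∷ r)

repeatHead : List ℕ → List ℕ
repeatHead []      = []
repeatHead (h ∷ r) = h ∷ h ∷ r

repeatHead-drop1 : ∀ {μ} → RepeatedHead μ → repeatHead (drop 1 μ) ≡ μ
repeatHead-drop1 (repeated h r) = refl

drop1-repeatHead : ∀ ν → drop 1 (repeatHead ν) ≡ ν
drop1-repeatHead []      = refl
drop1-repeatHead (_ ∷ _) = refl

smallestPart-repeatHead : ∀ h r → smallestPart (h ∷ h ∷ r) ≡ smallestPart (h ∷ r)
smallestPart-repeatHead h r = m≥n⇒m⊓n≡n (smallestPart-≤-head h r)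

IsVal-drop1 : ∀ {n h r} → IsVal (suc n) (h ∷ h ∷ r) → IsVal n (h ∷ r)
IsVal-drop1 ((_ ∷ ord , _ ∷ pos) , _ , _ ∷ bnd , notFull) =
  (ord , pos) , z<s , bnd , fromWitnessFalse (λ { (e ∷ es) → toWitnessFalse notFull (e ∷ e ∷ es) })

IsVal-repeatHead : ∀ {n h r} → IsVal n (h ∷ r) → IsVal (suc n) (h ∷ h ∷ r)
IsVal-repeatHead ((ord , pos@(p ∷ _)) , _ , bnd@(b ∷ _) , notFull) =
  (≤-refl ∷ ord , p ∷ pos) , z<s , b ∷ bnd , fromWitnessFalse (λ { (_ ∷ es) → toWitnessFalse notFull es })

take-++-replicate : ∀ d xs {a : ℕ} {p q} → d ≤ p → d ≤ q
  → take d (xs ++ replicate p a) ≡ take d (xs ++ replicate q a)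
take-++-replicate zero    xs       _       _       = refl
take-++-replicate (suc d) (x ∷ xs) d<p     d<q     = cong (x ∷_) (take-++-replicate d xs (<⇒≤ d<p) (<⇒≤ d<q))
take-++-replicate (suc d) []       (s≤s p) (s≤s q) = cong (_ ∷_) (take-++-replicate d [] p q)

FirstPartsEqual-drop1 : ∀ {d h r} → FirstPartsEqual (suc d) (h ∷ h ∷ r) → FirstPartsEqual d (h ∷ r)
FirstPartsEqual-drop1 {d} {h} {r} (_ ∷ es) =
  subst (All (_≡ h)) (take-++-replicate d (h ∷ r) (n≤1+n d) ≤-refl) es

FirstPartsEqual-repeatHead : ∀ {d h r} → FirstPartsEqual d (h ∷ r) → FirstPartsEqual (suc d) (h ∷ h ∷ r)
FirstPartsEqual-repeatHead {d} {h} {r} es =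
  refl ∷ subst (All (_≡ h)) (take-++-replicate d (h ∷ r) ≤-refl (n≤1+n d)) es


-- Chains

-- The index s is the smallest part of the entry that the chain follows.
Follows : ℕ → ℕ → List ℕ → Set
Follows n s μ = FirstPartsEqual (n ∸ s) μ × IsVal n μ

ChainAfter : ℕ → ℕ → ∀ {m} → Vec (List ℕ) m → Set
ChainAfter n s []      = ⊤
ChainAfter n s (μ ∷ v) = Follows n s μ × ChainAfter n (smallestPart μ) v

Chains : ℕ → ℕ → ℕ → Set
Chains n s m = Σ (Vec (List ℕ) m) (ChainAfter n s)

ChainAfter-irrelevant : ∀ {n s m} → Irrelevant (ChainAfter n s {m})
ChainAfter-irrelevant {x = []}    tt        tt          = refl
ChainAfter-irrelevant {x = _ ∷ _} (f , c) (f' , c') =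
  cong₂ _,_ (×-irrelevant FirstPartsEqual-irrelevant IsVal-irrelevant f f') (ChainAfter-irrelevant c c')

FirstPartsEqual⇒RepeatedHead : ∀ {d n μ} → FirstPartsEqual (suc (suc d)) μ → IsVal n μ → RepeatedHead μ
FirstPartsEqual⇒RepeatedHead {μ = []}         _               (_ , () , _)
FirstPartsEqual⇒RepeatedHead {μ = h ∷ []}     (_ ∷ 0≡h ∷ _)   ((_ , h>0 ∷ _) , _) = ⊥-elim (<-irrefl 0≡h h>0)
FirstPartsEqual⇒RepeatedHead {μ = h ∷ _ ∷ r}  (_ ∷ refl ∷ _) _ = repeated h r

Follows-repeatedHead : ∀ {n s μ} → s < n → Follows (suc n) s μ → RepeatedHead μ
Follows-repeatedHead {n} {s} {μ} s<n (fpe , val) =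
  FirstPartsEqual⇒RepeatedHead (subst (λ d → FirstPartsEqual d μ) suc-n∸s fpe) val
  where
  suc-n∸s : suc n ∸ s ≡ suc (suc (n ∸ suc s))
  suc-n∸s = trans (+-∸-assoc 1 (<⇒≤ s<n)) (cong suc (+-∸-assoc 1 s<n))

Follows-drop1 : ∀ {n s h r} → s ≤ n → Follows (suc n) s (h ∷ h ∷ r) → Follows n s (h ∷ r)
Follows-drop1 {n} {h = h} {r} s≤n (fpe , val) =
  FirstPartsEqual-drop1 (subst (λ d → FirstPartsEqual d (h ∷ h ∷ r)) (+-∸-assoc 1 s≤n) fpe) , IsVal-drop1 {n} val

Follows-repeatHead : ∀ {n s h r} → s ≤ n → Follows n s (h ∷ r) → Follows (suc n) s (h ∷ h ∷ r)
Follows-repeatHead {n} {h = h} {r} s≤n (fpe , val) =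
  subst (λ d → FirstPartsEqual d (h ∷ h ∷ r)) (sym (+-∸-assoc 1 s≤n)) (FirstPartsEqual-repeatHead fpe)
  , IsVal-repeatHead {n} val

module _ {n : ℕ} where

  ChainAfter-drop1 : ∀ {s m} (v : Vec (List ℕ) m) → s < n → ChainAfter (suc n) s v → ChainAfter n s (map (drop 1) v)
  ChainAfter-drop1 []      _   _            = tt
  ChainAfter-drop1 {s} (μ ∷ v) s<n (fol , rest) with Follows-repeatedHead s<n fol
  ... | repeated h r = fol′ , ChainAfter-drop1 v (smallestPart<n (proj₂ fol′))
                                (subst (λ t → ChainAfter (suc n) t v) (smallestPart-repeatHead h r) rest)
    where
    fol′ : Follows n s (h ∷ r)
    fol′ = Follows-drop1 (<⇒≤ s<n) fol

  ChainAfter-repeatHead : ∀ {s m} (v : Vec (List ℕ) m) → s < n → ChainAfter n s v → ChainAfter (suc n) s (map repeatHead v)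
  ChainAfter-repeatHead []            _   _                        = tt
  ChainAfter-repeatHead ([] ∷ v)      _   ((_ , (_ , () , _)) , _)
  ChainAfter-repeatHead ((h ∷ r) ∷ v) s<n (fol , rest) =
    Follows-repeatHead (<⇒≤ s<n) fol
    , subst (λ t → ChainAfter (suc n) t (map repeatHead v)) (sym (smallestPart-repeatHead h r))
        (ChainAfter-repeatHead v (smallestPart<n (proj₂ fol)) rest)

  map-repeatHead-drop1 : ∀ {s m} (v : Vec (List ℕ) m) → s < n → ChainAfter (suc n) s v
    → map repeatHead (map (drop 1) v) ≡ v
  map-repeatHead-drop1 []      _   _            = refl
  map-repeatHead-drop1 (μ ∷ v) s<n (fol , rest) with Follows-repeatedHead s<n fol
  ... | repeated h r = cong ((h ∷ h ∷ r) ∷_) (map-repeatHead-drop1 v sp<n rest)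
    where
    sp<n : smallestPart (h ∷ h ∷ r) < n
    sp<n = subst (_< n) (sym (smallestPart-repeatHead h r)) (smallestPart<n (IsVal-drop1 {n} (proj₂ fol)))

map-drop1-repeatHead : ∀ {m} (v : Vec (List ℕ) m) → map (drop 1) (map repeatHead v) ≡ v
map-drop1-repeatHead []      = refl
map-drop1-repeatHead (ν ∷ v) = cong₂ _∷_ (drop1-repeatHead ν) (map-drop1-repeatHead v)

-- Since s < n, each entry has its first two parts equal; deleting the first one lands in Val n
-- and keeps the smallest part, hence the compatibility condition with the next entry.
Chains-drop1-↔ : ∀ {n s m} → s < n → Chains (suc n) s m ↔ Chains n s m
Chains-drop1-↔ s<n = Σ-restrict-↔ ChainAfter-irrelevant ChainAfter-irrelevant (map (drop 1)) (map repeatHead)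
  (ChainAfter-drop1 _ s<n) (ChainAfter-repeatHead _ s<n) (map-repeatHead-drop1 _ s<n) (λ _ → map-drop1-repeatHead _)

Chains-shrink-↔ : ∀ {n s m} → s < n → Chains n s m ↔ Chains (suc s) s m
Chains-shrink-↔ {n} {s} {m} s<n = subst (λ t → Chains t s m ↔ Chains (suc s) s m) (m∸n+n≡m s<n) (shrink (n ∸ suc s))
  where
  shrink : ∀ j → Chains (j + suc s) s m ↔ Chains (suc s) s m
  shrink zero    = ↔-refl
  shrink (suc j) = ↔-trans (Chains-drop1-↔ (m≤n+m (suc s) j)) (shrink j)

-- The recursive structure of ParSeq

ValChains : ℕ → ℕ → Set
ValChains n m = Σ (Vec (Val n) m) (Chain n)

Chain-irrelevant : ∀ {n m} → Irrelevant (Chain n {m})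
Chain-irrelevant {x = []}        tt       tt         = refl
Chain-irrelevant {x = _ ∷ []}    tt       tt         = refl
Chain-irrelevant {x = _ ∷ _ ∷ _} (c , ch) (c' , ch') =
  cong₂ _,_ (FirstPartsEqual-irrelevant c c') (Chain-irrelevant ch ch')

FirstPartsEqual-1 : ∀ {n} (x : Val n) → FirstPartsEqual 1 (proj₁ x)
FirstPartsEqual-1 ([]    , _ , () , _)
FirstPartsEqual-1 (_ ∷ _ , _)          = refl ∷ []

module _ {n : ℕ} where

  vals : ∀ {s m} (w : Vec (List ℕ) m) → ChainAfter n s w → Vec (Val n) m
  vals []      _              = []
  vals (μ ∷ w) ((_ , val) , c) = (μ , val) ∷ vals w c

  map-proj₁-vals : ∀ {s m} (w : Vec (List ℕ) m) (c : ChainAfter n s w) → map proj₁ (vals w c) ≡ w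
  map-proj₁-vals []      _       = refl
  map-proj₁-vals (μ ∷ w) (_ , c) = cong (μ ∷_) (map-proj₁-vals w c)

  vals-map-proj₁ : ∀ {s m} (v : Vec (Val n) m) (c : ChainAfter n s (map proj₁ v)) → vals (map proj₁ v) c ≡ v
  vals-map-proj₁ []              _               = refl
  vals-map-proj₁ ((μ , val) ∷ v) ((_ , val′) , c) =
    cong₂ _∷_ (cong (μ ,_) (IsVal-irrelevant val′ val)) (vals-map-proj₁ v c)

  forgetIsVal-↔ : ∀ {s m} → Σ (Vec (Val n) m) (ChainAfter n s ∘ map proj₁) ↔ Chains n s m
  forgetIsVal-↔ {s} = mk↔ₛ′ (λ (v , c) → map proj₁ v , c)
    (λ (w , c) → vals w c , subst (ChainAfter n s) (sym (map-proj₁-vals w c)) c)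
    (λ (w , c) → Σ-≡,≡→≡ (map-proj₁-vals w c , ChainAfter-irrelevant _ _))
    (λ (v , c) → Σ-≡,≡→≡ (vals-map-proj₁ v c , ChainAfter-irrelevant _ _))

  Chain-∷⇒ : ∀ {m} (x : Val n) (v : Vec (Val n) m)
    → Chain n (x ∷ v) → ChainAfter n (smallestPart (proj₁ x)) (map proj₁ v)
  Chain-∷⇒ x []      _        = tt
  Chain-∷⇒ x (y ∷ v) (c , ch) = (c , proj₂ y) , Chain-∷⇒ y v ch

  Chain-∷⇐ : ∀ {m} (x : Val n) (v : Vec (Val n) m)
    → ChainAfter n (smallestPart (proj₁ x)) (map proj₁ v) → Chain n (x ∷ v)
  Chain-∷⇐ x []      _              = tt
  Chain-∷⇐ x (y ∷ v) ((c , _) , ch) = c , Chain-∷⇐ y v ch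

  Chain-∷-↔ : ∀ {m} (x : Val n) → Σ (Vec (Val n) m) (λ v → Chain n (x ∷ v)) ↔ Chains n (smallestPart (proj₁ x)) m
  Chain-∷-↔ x = ↔-trans (Σ-⇔-↔ Chain-irrelevant ChainAfter-irrelevant (Chain-∷⇒ x _) (Chain-∷⇐ x _)) forgetIsVal-↔

ValChains↔Chains : ∀ {s m} → ValChains (suc s) m ↔ Chains (suc s) s m
ValChains↔Chains {s} = ↔-trans (Σ-⇔-↔ Chain-irrelevant ChainAfter-irrelevant (to _) (from _)) forgetIsVal-↔
  where
  to : ∀ {m} (v : Vec (Val (suc s)) m) → Chain (suc s) v → ChainAfter (suc s) s (map proj₁ v)
  to []      _  = tt
  to (x ∷ v) ch = (subst (λ d → FirstPartsEqual d (proj₁ x)) (sym (m+n∸n≡m 1 s)) (FirstPartsEqual-1 x) , proj₂ x)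
                  , Chain-∷⇒ x v ch
  from : ∀ {m} (v : Vec (Val (suc s)) m) → ChainAfter (suc s) s (map proj₁ v) → Chain (suc s) v
  from []      _       = tt
  from (x ∷ v) (_ , c) = Chain-∷⇐ x v c

ValChains-suc-↔ : ∀ {n m} → ValChains n (suc m) ↔ Σ (Val n) (λ x → ValChains (suc (smallestPart (proj₁ x))) m)
ValChains-suc-↔ {n} {m} = ↔-trans (Σ-Vec-uncons-↔ (Chain n)) (Σ-↔ ↔-refl (λ {x} → fibre x))
  where
  fibre : (x : Val n) → Σ (Vec (Val n) m) (λ v → Chain n (x ∷ v)) ↔ ValChains (suc (smallestPart (proj₁ x))) m
  fibre x = ↔-trans (Chain-∷-↔ x) (↔-trans (Chains-shrink-↔ (smallestPart<n (proj₂ x))) (↔-sym ValChains↔Chains))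

ParSeq-length-bound : ∀ {n s m} → 1 ≤ s → s ≤ n ∸ 2 → ParSeq (suc s) m → suc m ≤ n ∸ 2
ParSeq-length-bound {m = zero}              s≥1 s≤n∸2 _         = ≤-trans s≥1 s≤n∸2
ParSeq-length-bound {s = suc s} {m = suc m} _   s≤n∸2 (m<s , _) = ≤-trans (s≤s m<s) s≤n∸2

ParSeq↔ValChains : ∀ n k → ParSeq n k ↔ ValChains n k
ParSeq↔ValChains n zero    = mk↔ₛ′ (λ _ → [] , tt) (λ _ → tt) (λ { ([] , tt) → refl }) (λ _ → refl)
ParSeq↔ValChains n (suc m) = mk↔ₛ′ proj₂ (λ c → length-bound c , c) (λ _ → refl)
  (λ (_ , c) → cong (_, c) (≤-irrelevant _ _))
  where
  length-bound : ValChains n (suc m) → suc m ≤ n ∸ 2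
  length-bound c with Inverse.to ValChains-suc-↔ c
  ... | (_ , val) , c′ with smallestPart-bounds val
  ... | s≥1 , s≤n∸2 = ParSeq-length-bound {n} s≥1 s≤n∸2 (Inverse.from (ParSeq↔ValChains _ m) c′)

ParSeq-suc-↔ : ∀ {n m} → ParSeq n (suc m) ↔ Σ (Val n) (λ x → ParSeq (suc (smallestPart (proj₁ x))) m)
ParSeq-suc-↔ {n} {m} =
  ↔-trans (ParSeq↔ValChains n (suc m)) (↔-trans ValChains-suc-↔ (Σ-↔ ↔-refl (↔-sym (ParSeq↔ValChains _ m))))

-- Decomposing Val (n + 1) by smallest part

IsVal-length< : ∀ {n xs} → IsVal n xs → length xs < n
IsVal-length< {xs = _ ∷ _} ((_ , h>0 ∷ _) , _ , h≤ ∷ _ , _) = m∸n≢0⇒n<m (λ e → <-irrefl (sym e) (≤-trans h>0 h≤))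

IsVal-singleton : ∀ {n q} → 0 < q → q < n ∸ 1 → IsVal n (q ∷ [])
IsVal-singleton q>0 q<w =
  ([-] , q>0 ∷ []) , z<s , <⇒≤ q<w ∷ [] , fromWitnessFalse (λ { (e ∷ []) → <-irrefl e q<w })

Linked⇒All-≤ : ∀ {b h r} → Linked (λ a b → b ≤ a) (h ∷ r) → h ≤ b → All (_≤ b) (h ∷ r)
Linked⇒All-≤ ord h≤b = Linked⇒All (λ p q → ≤-trans q p) h≤b ord

Linked-replicate : ∀ t q → Linked (λ a b → b ≤ a) (q ∷ replicate t q)
Linked-replicate zero    q = [-]
Linked-replicate (suc t) q = ≤-refl ∷ Linked-replicate t q

All≡⇒replicate : ∀ {v : ℕ} xs → All (_≡ v) xs → xs ≡ replicate (length xs) v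
All≡⇒replicate []       []       = refl
All≡⇒replicate (_ ∷ xs) (e ∷ es) = cong₂ _∷_ e (All≡⇒replicate xs es)

Weighted : ℕ → (ℕ → Set) → Set
Weighted n F = Σ (Val n) (F ∘ smallestPart ∘ proj₁)

isSingleton : List ℕ → Bool
isSingleton (_ ∷ []) = true
isSingleton _        = false

hasRepeatedHead : List ℕ → Bool
hasRepeatedHead (h ∷ h' ∷ _) = isYes (h ≟ h')
hasRepeatedHead _            = false

hasRepeatedHead⇒RepeatedHead : ∀ {xs} → T (hasRepeatedHead xs) → RepeatedHead xs
hasRepeatedHead⇒RepeatedHead {h ∷ h' ∷ r} t with toWitness {a? = h ≟ h'} t
... | refl = repeated h r

data Descent : List ℕ → Set where
  descent : ∀ h {h'} r → h' ≤ h → Descent (suc h ∷ h' ∷ r)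

NonRepeated : ℕ → List ℕ → Set
NonRepeated n xs = (IsVal n xs × T (not (isSingleton xs))) × T (not (hasRepeatedHead xs))

NonRepeated⇒Descent : ∀ {n xs} → NonRepeated n xs → Descent xs
NonRepeated⇒Descent {xs = []}         (((_ , () , _) , _) , _)
NonRepeated⇒Descent {xs = _ ∷ []}     ((_ , ()) , _)
NonRepeated⇒Descent {xs = h ∷ h' ∷ r} ((((h'≤h ∷ _ , _) , _) , _) , h≢h')
  with ≤∧≢⇒< h'≤h (λ e → toWitnessFalse h≢h' (sym e))
... | s≤s h'≤h₀ = descent _ r h'≤h₀

module _ (n : ℕ) where

  full? : (ys : List ℕ) → Dec (All (_≡ n ∸ length ys) ys)
  full? ys = all? (λ x → x ≟ (n ∸ length ys)) ys

  -- Lowering λ₁ > λ₂ gives a partition in the ℓ × (n − ℓ) rectangle; when it is the full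
  -- rectangle, the one-row partition (n − ℓ) is used instead, which raiseHead undoes.
  lowerHead : List ℕ → List ℕ
  lowerHead (h ∷ h' ∷ r) with full? (pred h ∷ h' ∷ r)
  ... | yes _ = h' ∷ []
  ... | no  _ = pred h ∷ h' ∷ r
  lowerHead _ = []

  raiseHead : List ℕ → List ℕ
  raiseHead []           = []
  raiseHead (q ∷ [])     = suc q ∷ replicate (n ∸ suc q) q
  raiseHead (h ∷ h' ∷ r) = suc h ∷ h' ∷ r

  lowerHead-full : ∀ {h h' r} → All (_≡ n ∸ length (h ∷ h' ∷ r)) (h ∷ h' ∷ r) → lowerHead (suc h ∷ h' ∷ r) ≡ h' ∷ []
  lowerHead-full {h} {h'} {r} full with full? (h ∷ h' ∷ r)
  ... | yes _       = refl
  ... | no  notFull = ⊥-elim (notFull full)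

  lowerHead-notFull : ∀ {h h' r} → ¬ All (_≡ n ∸ length (h ∷ h' ∷ r)) (h ∷ h' ∷ r) → lowerHead (suc h ∷ h' ∷ r) ≡ h ∷ h' ∷ r
  lowerHead-notFull {h} {h'} {r} notFull with full? (h ∷ h' ∷ r)
  ... | yes full = ⊥-elim (notFull full)
  ... | no  _    = refl

  IsVal-lowered : ∀ {h h' r} → h' ≤ h → IsVal (suc n) (suc h ∷ h' ∷ r)
    → ¬ All (_≡ n ∸ length (h ∷ h' ∷ r)) (h ∷ h' ∷ r) → IsVal n (h ∷ h' ∷ r)
  IsVal-lowered {h} {h'} {r} h'≤h val@((_ ∷ ord , _ ∷ h'>0 ∷ pos) , _ , sh≤ ∷ _ , _) notFull =
    (h'≤h ∷ ord , ≤-trans h'>0 h'≤h ∷ h'>0 ∷ pos) , z<s , Linked⇒All-≤ (h'≤h ∷ ord) h≤w , fromWitnessFalse notFull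
    where
    h≤w : h ≤ n ∸ length (h ∷ h' ∷ r)
    h≤w = s≤s⁻¹ (subst (suc h ≤_) (+-∸-assoc 1 (s≤s⁻¹ (IsVal-length< {suc n} val))) sh≤)

  IsVal-fullLowered : ∀ {h h' r} → IsVal (suc n) (suc h ∷ h' ∷ r)
    → All (_≡ n ∸ length (h ∷ h' ∷ r)) (h ∷ h' ∷ r) → IsVal n (h' ∷ [])
  IsVal-fullLowered val@((_ , _ ∷ h'>0 ∷ _) , _) (_ ∷ h'≡w ∷ _) =
    IsVal-singleton {n} h'>0 (subst (_< n ∸ 1) (sym h'≡w) (∸-monoʳ-< (s≤s (s≤s z≤n)) (s≤s⁻¹ (IsVal-length< {suc n} val))))

  IsVal-raised : ∀ {h h' r} → IsVal n (h ∷ h' ∷ r) → IsVal (suc n) (suc h ∷ h' ∷ r)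
  IsVal-raised {h} {h'} {r} val@((h'≤h ∷ ord , _ ∷ pos) , _ , h≤w ∷ _ , _) =
    (h'≤sh ∷ ord , z<s ∷ pos) , z<s , Linked⇒All-≤ (h'≤sh ∷ ord) sh≤w
    , fromWitnessFalse (λ { (e ∷ e' ∷ _) → 1+n≰n (subst (_≤ h) (trans e' (sym e)) h'≤h) })
    where
    h'≤sh : h' ≤ suc h
    h'≤sh = m≤n⇒m≤1+n h'≤h
    sh≤w : suc h ≤ suc n ∸ length (suc h ∷ h' ∷ r)
    sh≤w = subst (suc h ≤_) (sym (+-∸-assoc 1 (<⇒≤ (IsVal-length< {n} val)))) (s≤s h≤w)

  raisedSingleton-width : ∀ {q t} → suc q < n → n ∸ suc q ≡ suc t → n ∸ suc t ≡ suc q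
  raisedSingleton-width sq<n eq = trans (cong (n ∸_) (sym eq)) (m∸[m∸n]≡n (<⇒≤ sq<n))

  raisedSingleton-IsVal : ∀ {q t} → 0 < q → suc q < n → n ∸ suc q ≡ suc t
    → IsVal (suc n) (suc q ∷ q ∷ replicate t q)
  raisedSingleton-IsVal {q} {t} q>0 sq<n eq =
    (n≤1+n q ∷ Linked-replicate t q , z<s ∷ q>0 ∷ replicate⁺ t q>0) , z<s
    , Linked⇒All-≤ (n≤1+n q ∷ Linked-replicate t q) (≤-reflexive (sym width))
    , fromWitnessFalse (λ { (e ∷ e' ∷ _) → 1+n≢n (trans e (sym e')) })
    where
    width : n ∸ suc (length (replicate t q)) ≡ suc q
    width = trans (cong (λ k → n ∸ suc k) (length-replicate t)) (raisedSingleton-width sq<n eq)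

  raisedSingleton-full : ∀ {q t} → suc q < n → n ∸ suc q ≡ suc t
    → All (_≡ n ∸ length (q ∷ q ∷ replicate t q)) (q ∷ q ∷ replicate t q)
  raisedSingleton-full {q} {t} sq<n eq =
    subst (λ w → All (_≡ w) (q ∷ q ∷ replicate t q)) (sym width) (refl ∷ refl ∷ replicate⁺ t refl)
    where
    width : n ∸ length (q ∷ q ∷ replicate t q) ≡ q
    width = begin
      n ∸ suc (suc (length (replicate t q))) ≡⟨ cong (λ k → n ∸ suc (suc k)) (length-replicate t) ⟩
      n ∸ suc (suc t)                         ≡⟨ pred[m∸n]≡m∸[1+n] n (suc t) ⟨
      pred (n ∸ suc t)                        ≡⟨ cong pred (raisedSingleton-width sq<n eq) ⟩
      q                                       ∎
      where open ≡-Reasoning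

  lowerHead-IsVal : ∀ {xs} → NonRepeated (suc n) xs → IsVal n (lowerHead xs)
  lowerHead-IsVal p@((val , _) , _) with NonRepeated⇒Descent p
  ... | descent h {h'} r h'≤h with full? (h ∷ h' ∷ r)
  ...   | yes full    = IsVal-fullLowered val full
  ...   | no  notFull = IsVal-lowered h'≤h val notFull

  lowerHead-smallestPart : ∀ {xs} → NonRepeated (suc n) xs → smallestPart (lowerHead xs) ≡ smallestPart xs
  lowerHead-smallestPart p with NonRepeated⇒Descent p
  ... | descent h {h'} r h'≤h with full? (h ∷ h' ∷ r)
  ...   | yes (_ ∷ h'≡w ∷ rest≡w) =
          sym (trans (m≥n⇒m⊓n≡n (≤-trans sp≤h' (m≤n⇒m≤1+n h'≤h))) (trans (smallestPart-all≡ (h'≡w ∷ rest≡w)) (sym h'≡w)))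
    where
    sp≤h' : smallestPart (h' ∷ r) ≤ h'
    sp≤h' = smallestPart-≤-head h' r
  ...   | no  _ = trans (m≥n⇒m⊓n≡n (≤-trans sp≤h' h'≤h)) (sym (m≥n⇒m⊓n≡n (≤-trans sp≤h' (m≤n⇒m≤1+n h'≤h))))
    where
    sp≤h' : smallestPart (h' ∷ r) ≤ h'
    sp≤h' = smallestPart-≤-head h' r

  raiseHead-lowerHead : ∀ {xs} → NonRepeated (suc n) xs → raiseHead (lowerHead xs) ≡ xs
  raiseHead-lowerHead p@((val , _) , _) with NonRepeated⇒Descent p
  ... | descent h {h'} r h'≤h with full? (h ∷ h' ∷ r)
  ...   | no  _                      = refl
  ...   | yes (h≡w ∷ h'≡w ∷ rest≡w) =
          cong₂ _∷_ (cong suc (trans h'≡w (sym h≡w))) (trans (cong (λ k → replicate k h') n∸suc-h') (cong (h' ∷_) r≡))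
    where
    w : ℕ
    w = n ∸ suc (suc (length r))
    n∸suc-h' : n ∸ suc h' ≡ suc (length r)
    n∸suc-h' = begin
      n ∸ suc h'         ≡⟨ cong (λ k → n ∸ suc k) h'≡w ⟩
      n ∸ suc w          ≡⟨ pred[m∸n]≡m∸[1+n] n w ⟨
      pred (n ∸ w)       ≡⟨ cong pred (m∸[m∸n]≡n (s≤s⁻¹ (IsVal-length< {suc n} val))) ⟩
      suc (length r)     ∎
      where open ≡-Reasoning
    r≡ : replicate (length r) h' ≡ r
    r≡ = sym (trans (All≡⇒replicate r rest≡w) (cong (replicate (length r)) (sym h'≡w)))

  raisedSingleton-rows : ∀ {q} → IsVal n (q ∷ []) → n ∸ suc q ≡ suc (n ∸ suc (suc q))
  raisedSingleton-rows val = +-∸-assoc 1 (1+smallestPart<n {n} val)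

  lowerHead-raiseHead : ∀ {ys} → IsVal n ys → lowerHead (raiseHead ys) ≡ ys
  lowerHead-raiseHead {q ∷ []} val =
    trans (cong (λ k → lowerHead (suc q ∷ replicate k q)) (raisedSingleton-rows val))
          (lowerHead-full (raisedSingleton-full (1+smallestPart<n {n} val) (raisedSingleton-rows val)))
  lowerHead-raiseHead {_ ∷ _ ∷ _} (_ , _ , _ , notFull) = lowerHead-notFull (toWitnessFalse notFull)

  raiseHead-NonRepeated : ∀ {ys} → IsVal n ys → NonRepeated (suc n) (raiseHead ys)
  raiseHead-NonRepeated {q ∷ []} val@((_ , q>0 ∷ _) , _) =
    subst (NonRepeated (suc n)) (cong (λ k → suc q ∷ replicate k q) (sym (raisedSingleton-rows val)))
      ((raisedSingleton-IsVal q>0 (1+smallestPart<n {n} val) (raisedSingleton-rows val) , tt) , fromWitnessFalse 1+n≢n)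
  raiseHead-NonRepeated {h ∷ h' ∷ r} val@((h'≤h ∷ _ , _) , _) =
    (IsVal-raised val , tt) , fromWitnessFalse (λ e → 1+n≰n (subst (_≤ h) (sym e) h'≤h))

  singletons-↔ : Σ (List ℕ) (λ xs → IsVal (suc n) xs × T (isSingleton xs)) ↔ Σ ℕ (_< n ∸ 1)
  singletons-↔ = Σ-restrict-↔ (×-irrelevant IsVal-irrelevant T-irrelevant) <-irrelevant
    (pred ∘ smallestPart) (λ j → suc j ∷ []) to from from∘to (λ _ → refl)
    where
    to : ∀ {xs} → IsVal (suc n) xs × T (isSingleton xs) → pred (smallestPart xs) < n ∸ 1
    to {q ∷ []} (val , _) with smallestPart-bounds {suc n} val
    ... | s≤s _ , q≤w = q≤w
    from : ∀ {j} → j < n ∸ 1 → IsVal (suc n) (suc j ∷ []) × T (isSingleton (suc j ∷ []))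
    from j<w = IsVal-singleton {suc n} z<s (bound n j<w) , tt
      where
      bound : ∀ {j} n → j < n ∸ 1 → suc j < n
      bound (suc n) j<n = s≤s j<n
    from∘to : ∀ {xs} → IsVal (suc n) xs × T (isSingleton xs) → suc (pred (smallestPart xs)) ∷ [] ≡ xs
    from∘to {suc q ∷ []} _ = refl
    from∘to {zero  ∷ []} (((_ , () ∷ _) , _) , _)

  repeated-↔ : Σ (List ℕ) (λ xs → (IsVal (suc n) xs × T (not (isSingleton xs))) × T (hasRepeatedHead xs)) ↔ Val n
  repeated-↔ = Σ-restrict-↔ (×-irrelevant (×-irrelevant IsVal-irrelevant T-irrelevant) T-irrelevant) IsVal-irrelevant
    (drop 1) repeatHead to from
    (λ (_ , t) → repeatHead-drop1 (hasRepeatedHead⇒RepeatedHead t)) (λ _ → drop1-repeatHead _)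
    where
    to : ∀ {xs} → (IsVal (suc n) xs × T (not (isSingleton xs))) × T (hasRepeatedHead xs) → IsVal n (drop 1 xs)
    to {xs} ((val , _) , t) with hasRepeatedHead⇒RepeatedHead {xs} t
    ... | repeated _ _ = IsVal-drop1 {n} val
    from : ∀ {ys} → IsVal n ys → (IsVal (suc n) (repeatHead ys) × T (not (isSingleton (repeatHead ys)))) × T (hasRepeatedHead (repeatHead ys))
    from {[]}    (_ , () , _)
    from {_ ∷ _} val = (IsVal-repeatHead {n} val , tt) , fromWitness refl

  nonRepeated-↔ : Σ (List ℕ) (NonRepeated (suc n)) ↔ Val n
  nonRepeated-↔ = Σ-restrict-↔ (×-irrelevant (×-irrelevant IsVal-irrelevant T-irrelevant) T-irrelevant) IsVal-irrelevant
    lowerHead raiseHead lowerHead-IsVal raiseHead-NonRepeated raiseHead-lowerHead lowerHead-raiseHead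

Weighted-suc-↔ : ∀ n (F : ℕ → Set)
  → Weighted (suc n) F ↔ (Σ (Σ ℕ (_< n ∸ 1)) (F ∘ suc ∘ proj₁) ⊎ Weighted n F ⊎ Weighted n F)
Weighted-suc-↔ n F =
  ↔-trans (Σ-split-↔ (F ∘ smallestPart) isSingleton)
  (↔-trans (↔-refl ⊎-↔ Σ-split-↔ (F ∘ smallestPart) hasRepeatedHead)
           (Σ-reweight-↔ F (singletons-↔ n) singleton-weight
             ⊎-↔ (Σ-reweight-↔ F (repeated-↔ n) repeated-weight
             ⊎-↔ Σ-reweight-↔ F (nonRepeated-↔ n) (λ (_ , p) → lowerHead-smallestPart n p))))
  where
  singleton-weight : ∀ ((xs , _) : Σ (List ℕ) (λ xs → IsVal (suc n) xs × T (isSingleton xs)))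
    → suc (pred (smallestPart xs)) ≡ smallestPart xs
  singleton-weight (suc _ ∷ [] , _) = refl
  singleton-weight (zero  ∷ [] , ((_ , () ∷ _) , _) , _)
  repeated-weight : ∀ ((xs , _) : Σ (List ℕ) (λ xs → (IsVal (suc n) xs × T (not (isSingleton xs))) × T (hasRepeatedHead xs)))
    → smallestPart (drop 1 xs) ≡ smallestPart xs
  repeated-weight (xs , _ , t) with hasRepeatedHead⇒RepeatedHead {xs} t
  ... | repeated h r = sym (smallestPart-repeatHead h r)

ParSeq-recurrence-↔ : ∀ n k → ParSeq (suc n) (suc k)
  ↔ (Σ (Σ ℕ (_< n ∸ 1)) (λ x → ParSeq (2 + proj₁ x) k) ⊎ ParSeq n (suc k) ⊎ ParSeq n (suc k))
ParSeq-recurrence-↔ n k = begin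
  ParSeq (suc n) (suc k)                                                ↔⟨ ParSeq-suc-↔ ⟩
  Weighted (suc n) F                                                    ↔⟨ Weighted-suc-↔ n F ⟩
  (Σ (Σ ℕ (_< n ∸ 1)) (F ∘ suc ∘ proj₁) ⊎ Weighted n F ⊎ Weighted n F) ↔⟨ ↔-refl ⊎-↔ (ParSeq-suc-↔ ⊎-↔ ParSeq-suc-↔) ⟨
  (Σ (Σ ℕ (_< n ∸ 1)) (F ∘ suc ∘ proj₁) ⊎ ParSeq n (suc k) ⊎ ParSeq n (suc k)) ∎
  where
  open EquationalReasoning
  F : ℕ → Set
  F s = ParSeq (suc s) k

ParSeq-count≡0 : ∀ {k} (c : ℕ → ℕ) → (∀ i → ParSeq i k ↔ Fin (c i)) → ∀ j → j < k → c (2 + j) ≡ 0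
ParSeq-count≡0 {suc k} c count j (s≤s j≤k) =
  ↔Fin⇒≡0 (λ (k<j , _) → <-irrefl refl (≤-trans (s≤s j≤k) k<j)) (count (2 + j))

proposition3p14 : (n k : ℕ) → 1 ≤ k → (a b : ℕ) (c : ℕ → ℕ)
    → (ParSeq n k ↔ Fin a)
    → (ParSeq (n ∸ 1) k ↔ Fin b)
    → ((i : ℕ) → ParSeq i (k ∸ 1) ↔ Fin (c i))
    → a ≡ 2 * b + sumFromTo (suc k) (n ∸ 1) c
proposition3p14 zero (suc k) _ a b c ea eb _
  rewrite ↔Fin⇒≡0 (λ { (() , _) }) ea | ↔Fin⇒≡0 (λ { (() , _) }) eb = refl
proposition3p14 (suc n) (suc k) _ a b c ea eb ec = begin
  a                                   ≡⟨ Fin-↔-injective (↔-trans (↔-sym ea) count) ⟩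
  S + (b + b)                         ≡⟨ +-comm S (b + b) ⟩
  b + b + S                           ≡⟨ cong₂ _+_ (cong (b +_) (sym (+-identityʳ b))) S≡ ⟩
  2 * b + sumFromTo (suc (suc k)) n c ∎
  where
  open ≡-Reasoning
  S : ℕ
  S = sum (applyUpTo (c ∘ (2 +_)) (n ∸ 1))
  count : ParSeq (suc n) (suc k) ↔ Fin (S + (b + b))
  count = ↔-trans (ParSeq-recurrence-↔ n k)
    (↔-trans (Σ<↔Fin-sum _ _ (ec ∘ (2 +_)) (n ∸ 1) ⊎-↔ (eb ⊎-↔ eb)) (↔-trans (↔-refl ⊎-↔ ↔-sym +↔⊎) (↔-sym +↔⊎)))
  S≡ : S ≡ sumFromTo (suc (suc k)) n c
  S≡ = trans (sum-applyUpTo-dropZeros k (n ∸ 1) (c ∘ (2 +_)) (ParSeq-count≡0 c ec))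
             (cong (sum ∘ applyUpTo (c ∘ (2 +_) ∘ (k +_))) (∸-+-assoc n 1 k))
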